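{- For any finite vocabulary $V$ and any relation $R\subseteq\mathcal{P}(V)\times\mathcal{P}(V)$ there is a mental program $\pi$ over $V$ such that $R_\pi=R$.
   Context: Mental programs over a finite vocabulary $V$: $\pi::=p\leftarrow\top\mid p\leftarrow\bot\mid\beta?\mid\pi\cup\pi\mid\pi;\pi\mid\pi\cap\pi$, where $p\in V$ and $\beta$ is a Boolean formula over $V$. For states $s,t\subseteq V$: $s\xrightarrow{p\leftarrow\top}t$ iff $t=s\cup\{p\}$; $s\xrightarrow{p\leftarrow\bot}t$ iff $t=s\setminus\{p\}$; $s\xrightarrow{\beta?}t$ iff $s=t$ and $s\vDash\beta$; $s\xrightarrow{\pi_1\cup\pi_2}t$ iff $s\xrightarrow{\pi_1}t$ or $s\xrightarrow{\pi_2}t$; $s\xrightarrow{\pi_1;\pi_2}t$ iff there is $u\subseteq V$ with $s\xrightarrow{\pi_1}u$ and $u\xrightarrow{\pi_2}t$; $s\xrightarrow{\pi_1\cap\pi_2}t$ iff $s\xrightarrow{\pi_1}t$ and $s\xrightarrow{\pi_2}t$. $R_\pi:=\{(s,t)\mid s,t\subseteq V,\ s\xrightarrow{\pi}t\}$. -}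

module Defs where

open import Data.Nat using (ℕ)
open import Data.Fin using (Fin)
open import Data.Bool using (Bool; true; false; _∧_; _∨_; not)
open import Data.Fin.Subset using (Subset; _∈_; _∉_; ⁅_⁆; _∪_; _─_)
open import Relation.Binary.PropositionalEquality using (_≡_)
open import Data.Product using (_×_; ∃)
open import Data.Sum using (_⊎_)
open import Data.Vec using (lookup)

-- Vocabulary V = Fin n (any finite set up to bijection); states s ⊆ V are Subset n.

data Form (n : ℕ) : Set where
  atom : Fin n → Form n
  ⊤f   : Form n
  ⊥f   : Form n
  ¬f_  : Form n → Form n
  _∧f_ : Form n → Form n → Form n
  _∨f_ : Form n → Form n → Form n

eval : {n : ℕ} → Subset n → Form n → Bool
eval s (atom p) = lookup s p
eval s ⊤f = true
eval s ⊥f = false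
eval s (¬f β) = not (eval s β)
eval s (β ∧f γ) = eval s β ∧ eval s γ
eval s (β ∨f γ) = eval s β ∨ eval s γ

_⊨_ : {n : ℕ} → Subset n → Form n → Set
s ⊨ β = eval s β ≡ true

data Prog (n : ℕ) : Set where
  assign⊤ : Fin n → Prog n
  assign⊥ : Fin n → Prog n
  test    : Form n → Prog n
  _∪p_    : Prog n → Prog n → Prog n
  _⨾_     : Prog n → Prog n → Prog n
  _∩p_    : Prog n → Prog n → Prog n

_-[_]→_ : {n : ℕ} → Subset n → Prog n → Subset n → Set
s -[ assign⊤ p ]→ t = t ≡ s ∪ ⁅ p ⁆
s -[ assign⊥ p ]→ t = t ≡ s ─ ⁅ p ⁆
s -[ test β ]→ t = (s ≡ t) × (s ⊨ β)
s -[ π₁ ∪p π₂ ]→ t = (s -[ π₁ ]→ t) ⊎ (s -[ π₂ ]→ t)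
s -[ π₁ ⨾ π₂ ]→ t = ∃ λ u → (s -[ π₁ ]→ u) × (u -[ π₂ ]→ t)
s -[ π₁ ∩p π₂ ]→ t = (s -[ π₁ ]→ t) × (s -[ π₂ ]→ t)

-- A relation R ⊆ P(V) × P(V), given by its characteristic function
-- (every subset of the finite set P(V) × P(V) is of this form).
Rel : ℕ → Set
Rel n = Subset n → Subset n → Bool

_realises_ : {n : ℕ} → Prog n → Rel n → Set
π realises R = ∀ s t → ((s -[ π ]→ t) → R s t ≡ true) × (R s t ≡ true → s -[ π ]→ t)

-- A program can test the current state exhaustively with the conjunction of
-- literals characterising it, and can move from any state to any other by
-- nondeterministically setting every atom and then testing the characteristic
-- formula of the target. So for each pair (a, b) there is a program realising
-- exactly the singleton relation {(a, b)}, and R is the finite union of those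
-- singletons it contains.
module Submission where

open import Defs
open import Data.Nat using (ℕ; zero; suc)
open import Data.Product using (∃; _,_; _×_)
open import Data.Sum using (inj₁; inj₂)
open import Data.Bool using (Bool; true; false; not; _∧_; if_then_else_)
open import Data.Bool.Properties using (∨-zeroʳ; ∨-identityʳ; not-injective)
open import Data.Fin using (Fin; zero; suc)
open import Data.Fin.Properties using (_≟_)
open import Data.Fin.Subset using (Subset; ⁅_⁆; _∪_; _─_)
open import Data.Fin.Subset.Properties using (∪-identityʳ; p─⊥≡p)
open import Data.Vec using (Vec; []; _∷_; lookup; tabulate; _[_]≔_)
open import Data.Vec.Properties using (lookup∘update; lookup∘update′; tabulate-cong; tabulate∘lookup)
open import Data.List using (List; []; _∷_; allFin)
open import Data.List.Relation.Unary.All using (All; []; _∷_)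
import Data.List.Relation.Unary.All as All
open import Data.List.Relation.Unary.Any using (here; there)
open import Data.List.Membership.Propositional using (_∉_)
open import Data.List.Membership.Propositional.Properties using (∈-allFin)
open import Relation.Binary.PropositionalEquality
open import Relation.Nullary using (yes; no)
open import Data.Empty using (⊥-elim)

private
  variable
    n k : ℕ

lookup-extensionality : {A : Set} (xs ys : Vec A n) → (∀ i → lookup xs i ≡ lookup ys i) → xs ≡ ys
lookup-extensionality xs ys same = begin
  xs                   ≡⟨ tabulate∘lookup xs ⟨
  tabulate (lookup xs) ≡⟨ tabulate-cong same ⟩
  tabulate (lookup ys) ≡⟨ tabulate∘lookup ys ⟩
  ys                   ∎
  where open ≡-Reasoning

∪⁅⁆≡[]≔true : (s : Subset n) (p : Fin n) → s ∪ ⁅ p ⁆ ≡ s [ p ]≔ true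
∪⁅⁆≡[]≔true (x ∷ s) zero    = cong₂ _∷_ (∨-zeroʳ x) (∪-identityʳ s)
∪⁅⁆≡[]≔true (x ∷ s) (suc p) = cong₂ _∷_ (∨-identityʳ x) (∪⁅⁆≡[]≔true s p)

─⁅⁆≡[]≔false : (s : Subset n) (p : Fin n) → s ─ ⁅ p ⁆ ≡ s [ p ]≔ false
─⁅⁆≡[]≔false (x ∷ s) zero    = cong (false ∷_) (p─⊥≡p s)
─⁅⁆≡[]≔false (x ∷ s) (suc p) = cong (x ∷_) (─⁅⁆≡[]≔false s p)

lit : Fin n → Bool → Form n
lit p true  = atom p
lit p false = ¬f atom p

lit-sound : ∀ (s : Subset n) p x → s ⊨ lit p x → lookup s p ≡ x
lit-sound s p true  holds = holds
lit-sound s p false holds = not-injective holds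

lit-complete : ∀ (s : Subset n) p x → lookup s p ≡ x → s ⊨ lit p x
lit-complete s p true  s[p]≡x = s[p]≡x
lit-complete s p false s[p]≡x = cong not s[p]≡x

∧-≡-true : ∀ {x y} → x ∧ y ≡ true → x ≡ true × y ≡ true
∧-≡-true {true} {true} refl = refl , refl

agreesOn : List (Fin n) → Subset n → Form n
agreesOn []       b = ⊤f
agreesOn (p ∷ ps) b = lit p (lookup b p) ∧f agreesOn ps b

agreesOn-sound : ∀ ps (b s : Subset n) → s ⊨ agreesOn ps b → All (λ q → lookup s q ≡ lookup b q) ps
agreesOn-sound []       b s _     = []
agreesOn-sound (p ∷ ps) b s holds with ∧-≡-true holds
... | here-holds , rest-holds = lit-sound s p _ here-holds ∷ agreesOn-sound ps b s rest-holds

agreesOn-refl : ∀ ps (b : Subset n) → b ⊨ agreesOn ps b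
agreesOn-refl []       b = refl
agreesOn-refl (p ∷ ps) b = cong₂ _∧_ (lit-complete b p _ refl) (agreesOn-refl ps b)

char : Subset n → Form n
char {n} = agreesOn (allFin n)

char-sound : (b s : Subset n) → s ⊨ char b → s ≡ b
char-sound {n} b s holds = lookup-extensionality s b λ q →
  All.lookup (agreesOn-sound (allFin n) b s holds) (∈-allFin q)

char-refl : (b : Subset n) → b ⊨ char b
char-refl {n} = agreesOn-refl (allFin n)

assign-reaches : (s : Subset n) (p : Fin n) (x : Bool) → s -[ assign⊤ p ∪p assign⊥ p ]→ (s [ p ]≔ x)
assign-reaches s p true  = inj₁ (sym (∪⁅⁆≡[]≔true s p))
assign-reaches s p false = inj₂ (sym (─⁅⁆≡[]≔false s p))

havoc : List (Fin n) → Prog n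
havoc []       = test ⊤f
havoc (p ∷ ps) = (assign⊤ p ∪p assign⊥ p) ⨾ havoc ps

havoc-complete : ∀ ps (s t : Subset n) → (∀ q → q ∉ ps → lookup s q ≡ lookup t q) → s -[ havoc ps ]→ t
havoc-complete []       s t agree = lookup-extensionality s t (λ q → agree q λ ()) , refl
havoc-complete {n} (p ∷ ps) s t agree =
  s′ , assign-reaches s p (lookup t p) , havoc-complete ps s′ t agree′
  where
  s′ : Subset n
  s′ = s [ p ]≔ lookup t p
  agree′ : ∀ q → q ∉ ps → lookup s′ q ≡ lookup t q
  agree′ q q∉ps with q ≟ p
  ... | yes refl = lookup∘update p s (lookup t p)
  ... | no q≢p   = trans (lookup∘update′ q≢p s (lookup t p))
                         (agree q λ { (here q≡p) → q≢p q≡p ; (there q∈ps) → q∉ps q∈ps })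

transition : Subset n → Subset n → Prog n
transition {n} a b = test (char a) ⨾ (havoc (allFin n) ⨾ test (char b))

transition-sound : (a b s t : Subset n) → s -[ transition a b ]→ t → s ≡ a × t ≡ b
transition-sound a b s t (_ , (refl , s⊨a) , (_ , _ , (refl , t⊨b))) = char-sound a s s⊨a , char-sound b t t⊨b

transition-complete : (a b : Subset n) → a -[ transition a b ]→ b
transition-complete {n} a b =
  a , (refl , char-refl a) ,
  b , havoc-complete (allFin n) a b (λ q q∉allFin → ⊥-elim (q∉allFin (∈-allFin q))) ,
  (refl , char-refl b)

⋃ₚ : (Subset k → Prog n) → Prog n
⋃ₚ {zero}  π = π []
⋃ₚ {suc k} π = ⋃ₚ (λ u → π (true ∷ u)) ∪p ⋃ₚ (λ u → π (false ∷ u))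

⋃ₚ-sound : ∀ (π : Subset k → Prog n) s t → s -[ ⋃ₚ π ]→ t → ∃ λ u → s -[ π u ]→ t
⋃ₚ-sound {zero}  π s t step = [] , step
⋃ₚ-sound {suc k} π s t (inj₁ step) with ⋃ₚ-sound (λ u → π (true ∷ u)) s t step
... | u , step′ = true ∷ u , step′
⋃ₚ-sound {suc k} π s t (inj₂ step) with ⋃ₚ-sound (λ u → π (false ∷ u)) s t step
... | u , step′ = false ∷ u , step′

⋃ₚ-complete : ∀ (π : Subset k → Prog n) s t u → s -[ π u ]→ t → s -[ ⋃ₚ π ]→ t
⋃ₚ-complete π s t []          step = step
⋃ₚ-complete π s t (true ∷ u)  step = inj₁ (⋃ₚ-complete _ s t u step)
⋃ₚ-complete π s t (false ∷ u) step = inj₂ (⋃ₚ-complete _ s t u step)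

guardedTransition : Rel n → Subset n → Subset n → Prog n
guardedTransition R a b = if R a b then transition a b else test ⊥f

guardedTransition-sound : ∀ (R : Rel n) a b s t → s -[ guardedTransition R a b ]→ t → R s t ≡ true
guardedTransition-sound R a b s t step with R a b in Rab
... | true with transition-sound a b s t step
...   | refl , refl = Rab
guardedTransition-sound R a b s t (_ , ()) | false

guardedTransition-complete : ∀ (R : Rel n) s t → R s t ≡ true → s -[ guardedTransition R s t ]→ t
guardedTransition-complete R s t Rst rewrite Rst = transition-complete s t

lemma11 : (n : ℕ) (R : Rel n) → ∃ λ (π : Prog n) → π realises R
lemma11 n R = π , λ s t → sound s t , complete s t
  where
  π : Prog n
  π = ⋃ₚ λ a → ⋃ₚ λ b → guardedTransition R a b

  sound : ∀ s t → s -[ π ]→ t → R s t ≡ true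
  sound s t step with ⋃ₚ-sound _ s t step
  ... | a , step′ with ⋃ₚ-sound _ s t step′
  ...   | b , step″ = guardedTransition-sound R a b s t step″

  complete : ∀ s t → R s t ≡ true → s -[ π ]→ t
  complete s t Rst = ⋃ₚ-complete _ s t s (⋃ₚ-complete _ s t t (guardedTransition-complete R s t Rst))
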